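{- Let $\mathcal M$ be the structure for $\Sigma_N=\{0,s,N,p\}$ with universe $|\mathcal M|=\{(1,n)\mid n\in\mathbb N\}\cup\{(2,z)\mid z\in\mathbb Z\}$, $0_{\mathcal M}=(1,0)$, $s_{\mathcal M}(i,y)=(i,y+1)$, $N_{\mathcal M}=|\mathcal M|$, and $p_{\mathcal M}=|\mathcal M|^2\setminus(\pi_1\cup\pi_2\cup\pi_3)$, where $\pi_1=\{((1,n),(2,2n))\mid n\in\mathbb N\}$, $\pi_2=\{((2,n),(1,2n))\mid n\in\mathbb N\}$, $\pi_3=\{((2,-1-n),(2,-2-2n))\mid n\in\mathbb N\}$. Then $\mathcal M\not\models H$.
   Context: Write $1=s0$, $\forall x\in N.\,A$ for $\forall x(N(x)\to A)$, and $A_1,\dots,A_n\to B$ for $A_1\wedge\dots\wedge A_n\to B$. The 2-Hydra formula is $H=(H_a,H_b,H_c,H_d\to\forall x,y\in N.\,p(x,y))$ where $H_a$: $\forall x\in N.\ p(0,0)\wedge p(1,0)\wedge p(x,1)$; $H_b$: $\forall x,y\in N.\ p(x,y)\to p(sx,ssy)$; $H_c$: $\forall y\in N.\ p(sy,y)\to p(0,ssy)$; $H_d$: $\forall x\in N.\ p(sx,x)\to p(ssx,0)$. -}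

module Defs where

open import Data.Nat using (ℕ; zero; suc; _*_)
open import Data.Integer using (ℤ; +_; -[1+_]) renaming (suc to sucℤ)
open import Data.Unit using (⊤)
open import Relation.Nullary using (¬_)

record Structure : Set₁ where
  field
    U  : Set
    z  : U
    s  : U → U
    N  : U → Set
    p  : U → U → Set

-- Satisfaction of the 2-Hydra formula H in a structure M
-- (1 = s 0; ∀ x ∈ N. A  is  ∀ x (N x → A)).
module _ (M : Structure) where
  open Structure M

  one′ : U
  one′ = s z

  HaSat : Set
  HaSat = ∀ x → N x → (p z z × p one′ z × p x one′)
    where open import Data.Product using (_×_)

  HbSat : Set
  HbSat = ∀ x y → N x → N y → p x y → p (s x) (s (s y))

  HcSat : Set
  HcSat = ∀ y → N y → p (s y) y → p z (s (s y))

  HdSat : Set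
  HdSat = ∀ x → N x → p (s x) x → p (s (s x)) z

  SatH : Set
  SatH = HaSat → HbSat → HcSat → HdSat → ∀ x y → N x → N y → p x y

data UM : Set where
  one : ℕ → UM
  two : ℤ → UM

sM : UM → UM
sM (one n) = one (suc n)
sM (two k) = two (sucℤ k)

-- π₁ ∪ π₂ ∪ π₃
-- π₁ = {((1,n),(2,2n))}, π₂ = {((2,n),(1,2n))},
-- π₃ = {((2,-1-n),(2,-2-2n))}; note -[1+ m ] = -1-m, so -2-2n = -[1+ 1+2n ].
data Π : UM → UM → Set where
  π₁ : ∀ n → Π (one n) (two (+ (2 * n)))
  π₂ : ∀ n → Π (two (+ n)) (one (2 * n))
  π₃ : ∀ n → Π (two -[1+ n ]) (two -[1+ suc (2 * n) ])

ℳ : Structure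
ℳ = record
  { U = UM
  ; z = one 0
  ; s = sM
  ; N = λ _ → ⊤
  ; p = λ a b → ¬ Π a b
  }

-- In ℳ the excluded set π₁ ∪ π₂ ∪ π₃ is the graph of a doubling map, which commutes with
-- successors, double (s a) = s (s (double a)), except at a = (2,-1), where (2,0) ↦ (1,0)
-- is not s s of anything. This gives Hb. The premises of Hc and Hd force s (s y) = (2,0),
-- and at y = (2,-2) the pair (s y, y) lies in π₃. Ha holds since (1,1) is not a double.
-- Yet p fails at ((1,0),(2,0)) ∈ π₁.
module Submission where

open import Defs
open import Relation.Nullary using (¬_)
open import Data.Nat using (zero; suc; _*_)
open import Data.Nat.Properties using (*-suc; m*n≡1⇒m≡1)
open import Data.Integer using (+_; -[1+_]) renaming (pred to predℤ)
open import Data.Integer.Properties using (pred-suc)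
open import Data.Product using (_,_)
open import Data.Sum using (_⊎_; inj₁; inj₂)
open import Data.Unit using (tt)
open import Data.Empty using (⊥-elim)
open import Function using (_∘_)
open import Relation.Binary.PropositionalEquality

double : UM → UM
double (one n)        = two (+ (2 * n))
double (two (+ n))    = one (2 * n)
double (two -[1+ n ]) = two -[1+ suc (2 * n) ]

Π-double : ∀ c → Π c (double c)
Π-double (one n)        = π₁ n
Π-double (two (+ n))    = π₂ n
Π-double (two -[1+ n ]) = π₃ n

Π⇒≡double : ∀ {c d} → Π c d → d ≡ double c
Π⇒≡double (π₁ n) = refl
Π⇒≡double (π₂ n) = refl
Π⇒≡double (π₃ n) = refl

sM-injective : ∀ {a b} → sM a ≡ sM b → a ≡ b
sM-injective {one _} {one _} refl = refl
sM-injective {two i} {two j} e = begin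
  two i                   ≡⟨ cong two (sym (pred-suc i)) ⟩
  predUM (sM (two i))     ≡⟨ cong predUM e ⟩
  predUM (sM (two j))     ≡⟨ cong two (pred-suc j) ⟩
  two j                   ∎
  where
  open ≡-Reasoning
  predUM : UM → UM
  predUM (two k) = two (predℤ k)
  predUM a       = a

sM≢one0 : ∀ a → sM a ≢ one 0
sM≢one0 (one _) ()
sM≢one0 (two _) ()

double-sM : ∀ a → double (sM a) ≡ sM (sM (double a)) ⊎ a ≡ two -[1+ 0 ]
double-sM (one n)            = inj₁ (cong (two ∘ +_) (*-suc 2 n))
double-sM (two (+ n))        = inj₁ (cong one (*-suc 2 n))
double-sM (two -[1+ zero ])  = inj₂ refl
double-sM (two -[1+ suc n ]) = inj₁ (cong (λ k → sM (sM (two -[1+ suc k ]))) (sym (*-suc 2 n)))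

double≢one1 : ∀ c → double c ≢ one 1
double≢one1 (one _)        ()
double≢one1 (two (+ n))    e with m*n≡1⇒m≡1 2 n (cong (λ { (one k) → k ; _ → 0 }) e)
... | ()
double≢one1 (two -[1+ _ ]) ()

double≡one0 : ∀ {c} → double c ≡ one 0 → c ≡ two (+ 0)
double≡one0 {two (+ zero)} refl = refl

Π-sM-sM⇒Π : ∀ {a b} → Π (sM a) (sM (sM b)) → Π a b
Π-sM-sM⇒Π {a} {b} π with double-sM a
... | inj₁ e    = subst (Π a) (sym (sM-injective (sM-injective (trans (Π⇒≡double π) e)))) (Π-double a)
... | inj₂ refl = ⊥-elim (sM≢one0 (sM b) (Π⇒≡double π))

sM-sM≡two0⇒Π : ∀ {y} → sM (sM y) ≡ two (+ 0) → Π (sM y) y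
sM-sM≡two0⇒Π {y} e = subst (λ y → Π (sM y) y) (sM-injective (sM-injective (sym e))) (π₃ 0)

lemma5p3 : ¬ SatH ℳ
lemma5p3 h = h ha hb hc hd (one 0) (two (+ 0)) tt tt (π₁ 0)
  where
  ha : HaSat ℳ
  ha x _ = (λ ()) , (λ ()) , double≢one1 x ∘ sym ∘ Π⇒≡double
  hb : HbSat ℳ
  hb _ _ _ _ ¬π = ¬π ∘ Π-sM-sM⇒Π
  hc : HcSat ℳ
  hc _ _ ¬π = ¬π ∘ sM-sM≡two0⇒Π ∘ Π⇒≡double
  hd : HdSat ℳ
  hd _ _ ¬π = ¬π ∘ sM-sM≡two0⇒Π ∘ double≡one0 ∘ sym ∘ Π⇒≡double
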